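{- For all integers $n\geq 2$, $ac_1(n)=f_3(n-3)+f_3(n-1)$.
   Context: A composition of $n$ of length $s$ is a sequence $\sigma=(\sigma_1,\ldots,\sigma_s)$ of positive integers with $\sum_i\sigma_i=n$. A composition is anti-palindromic if $\sigma_i\neq\sigma_{s-i+1}$ for all $i$ with $i\neq\frac{s+1}{2}$. $ac_1(n)$ is the number of anti-palindromic compositions of $n$ of odd length. The tribonacci numbers are defined by $f_3(n)=0$ for $n<1$, $f_3(1)=1$, and $f_3(n)=f_3(n-1)+f_3(n-2)+f_3(n-3)$ for $n\geq 2$. -}

module Defs where

open import Data.Nat using (ℕ; zero; suc; _+_; _∸_; _≟_; _*_)
open import Data.List using (List; []; _∷_; length; map; concatMap; upTo; filter; lookup)
open import Data.Fin using (Fin; toℕ; opposite)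
open import Data.Product using (_×_; ∃)
open import Relation.Binary.PropositionalEquality using (_≡_)
open import Relation.Nullary using (¬_; Dec; ¬?)
open import Relation.Nullary.Decidable using (_×-dec_; _→-dec_)
open import Data.Bool using (Bool; true; false; not; T; T?)
open import Data.Fin.Properties using (all?)

-- Tribonacci: f3 n for n : ℕ (f3 0 = 0, f3 1 = 1, f3 2 = f3 1 + f3 0 + f3(-1) = 1, ...)
f3 : ℕ → ℕ
f3 zero = 0
f3 (suc zero) = 1
f3 (suc (suc zero)) = 1
f3 (suc (suc (suc n))) = f3 (suc (suc n)) + f3 (suc n) + f3 n

compsF : ℕ → ℕ → List (List ℕ)
compsF _ zero = [] ∷ []
compsF zero (suc _) = []
compsF (suc f) n = concatMap (λ k → map (suc k ∷_) (compsF f (n ∸ suc k))) (upTo n)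

-- The list of all compositions of n (fuel n suffices since every part is ≥ 1).
compositions : ℕ → List (List ℕ)
compositions n = compsF n n

-- σ is anti-palindromic: σ_i ≠ σ_{s-i+1} for every index i (0-based here:
-- σ[i] ≠ σ[s-1-i], where opposite i = s-1-i) except the middle one, i.e. except when 2i+1 = s.
AntiPalindromic : List ℕ → Set
AntiPalindromic σ =
  (i : Fin (length σ)) → ¬ (2 * toℕ i + 1 ≡ length σ) →
    ¬ (lookup σ i ≡ lookup σ (opposite i))

Odd? : ℕ → Bool
Odd? zero = false
Odd? (suc n) = not (Odd? n)

antiPal? : (σ : List ℕ) → Dec (AntiPalindromic σ)
antiPal? σ = all? (λ i → ¬? (2 * toℕ i + 1 ≟ length σ) →-dec ¬? (lookup σ i ≟ lookup σ (opposite i)))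

ac₁ : ℕ → ℕ
ac₁ n = length (filter (λ σ → T? (Odd? (length σ)) ×-dec antiPal? σ) (compositions n))

{-# OPTIONS --safe #-}
module Submission where

-- Splitting off the first and the last part, an odd-length anti-palindromic composition of m + 2
-- is either the single part m + 2 or a ∷ τ ++ [ b ] with a ≠ b and τ again odd-length and
-- anti-palindromic. Hence ac₁ (m + 2) = 1 + Σ_{s + d = m} P(s) ac₁(d), where P(s) counts the pairs
-- i + j = s with i ≠ j. Together with ac₁ 0 = 0 and ac₁ 1 = 1 this recurrence determines ac₁, and
-- since P(s + 2) = P(s) + 2, checking it for the tribonacci closed form reduces to the tribonacci
-- recurrence.

open import Defs
open import Data.Bool using (Bool; true; false; not; _∧_; T)
open import Data.Bool.Properties using (not-involutive)
open import Data.Fin using (Fin; toℕ; fromℕ<; opposite)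
open import Data.Fin.Properties using (toℕ-fromℕ<; toℕ<n; opposite-prop)
open import Data.List using (List; []; _∷_; _++_; length; map; concatMap; applyUpTo; upTo; filter; lookup)
open import Data.List.Properties using (map-++; map-∘; map-cong; map-applyUpTo; concatMap-cong; length-++)
open import Data.Nat
open import Data.Nat.Properties
open import Data.Nat.Induction using (<-rec)
open import Data.Nat.ListAction using (sum)
open import Data.Nat.ListAction.Properties using (sum-++)
open import Data.Nat.Tactic.RingSolver using (solve-∀)
open import Algebra.Properties.CommutativeSemigroup +-commutativeSemigroup using (interchange)
open import Data.Product using (_×_; _,_)
open import Data.Unit using (tt)
open import Function using (_∘_; id; _⇔_; mk⇔; Equivalence)
open import Relation.Binary.PropositionalEquality
open import Relation.Nullary using (Dec; does; ¬?)
open import Relation.Nullary.Decidable using (T?; _×-dec_; dec-true; does-⇔)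

open ≡-Reasoning

∑-syntax : {A : Set} → List A → (A → ℕ) → ℕ
∑-syntax xs f = sum (map f xs)

infix 5 ∑-syntax
syntax ∑-syntax xs (λ x → e) = ∑[ x ∈ xs ] e

private
  variable
    A B : Set

∑-++ : (f : A → ℕ) (xs ys : List A) → ∑[ x ∈ xs ++ ys ] f x ≡ (∑[ x ∈ xs ] f x) + (∑[ x ∈ ys ] f x)
∑-++ f xs ys = trans (cong sum (map-++ f xs ys)) (sum-++ (map f xs) (map f ys))

∑-concatMap : (f : B → ℕ) (F : A → List B) (xs : List A) →
              ∑[ y ∈ concatMap F xs ] f y ≡ ∑[ x ∈ xs ] ∑[ y ∈ F x ] f y
∑-concatMap f F []       = refl
∑-concatMap f F (x ∷ xs) =
  trans (∑-++ f (F x) (concatMap F xs)) (cong ((∑[ y ∈ F x ] f y) +_) (∑-concatMap f F xs))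

∑-map : (f : B → ℕ) (g : A → B) (xs : List A) → ∑[ y ∈ map g xs ] f y ≡ ∑[ x ∈ xs ] f (g x)
∑-map f g xs = cong sum (sym (map-∘ xs))

∑-cong : {f g : A → ℕ} → (∀ x → f x ≡ g x) → (xs : List A) → ∑[ x ∈ xs ] f x ≡ ∑[ x ∈ xs ] g x
∑-cong f≗g xs = cong sum (map-cong f≗g xs)

∑-*ˡ : (c : ℕ) (f : A → ℕ) (xs : List A) → ∑[ x ∈ xs ] c * f x ≡ c * (∑[ x ∈ xs ] f x)
∑-*ˡ c f []       = sym (*-zeroʳ c)
∑-*ˡ c f (x ∷ xs) = trans (cong (c * f x +_) (∑-*ˡ c f xs)) (sym (*-distribˡ-+ c (f x) _))

antidiagonalSum : ℕ → (ℕ → ℕ → ℕ) → ℕ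
antidiagonalSum zero    g = g 0 0
antidiagonalSum (suc m) g = g 0 (suc m) + antidiagonalSum m (λ i j → g (suc i) j)

infix 5 antidiagonalSum
syntax antidiagonalSum m (λ i j → e) = ∑[ i + j ≡ m ] e

antidiagonalSum-cong : ∀ m {g h : ℕ → ℕ → ℕ} → (∀ i j → i + j ≡ m → g i j ≡ h i j) →
                       ∑[ i + j ≡ m ] g i j ≡ ∑[ i + j ≡ m ] h i j
antidiagonalSum-cong zero    g≗h = g≗h 0 0 refl
antidiagonalSum-cong (suc m) g≗h =
  cong₂ _+_ (g≗h 0 (suc m) refl) (antidiagonalSum-cong m (λ i j eq → g≗h (suc i) j (cong suc eq)))

antidiagonal-snd≤ : ∀ {i j m} → i + j ≡ m → j ≤ m
antidiagonal-snd≤ {i} {j} i+j≡m = subst (j ≤_) i+j≡m (m≤n+m j i)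

antidiagonalSum-+ : ∀ m (g h : ℕ → ℕ → ℕ) →
                    ∑[ i + j ≡ m ] g i j + h i j ≡ (∑[ i + j ≡ m ] g i j) + (∑[ i + j ≡ m ] h i j)
antidiagonalSum-+ zero    g h = refl
antidiagonalSum-+ (suc m) g h =
  trans (cong (g 0 (suc m) + h 0 (suc m) +_) (antidiagonalSum-+ m _ _))
        (interchange (g 0 (suc m)) (h 0 (suc m)) _ _)

antidiagonalSum-*ˡ : ∀ m c (g : ℕ → ℕ → ℕ) → ∑[ i + j ≡ m ] c * g i j ≡ c * (∑[ i + j ≡ m ] g i j)
antidiagonalSum-*ˡ zero    c g = refl
antidiagonalSum-*ˡ (suc m) c g =
  trans (cong (c * g 0 (suc m) +_) (antidiagonalSum-*ˡ m c _)) (sym (*-distribˡ-+ c (g 0 (suc m)) _))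

antidiagonalSum-*ʳ : ∀ m c (g : ℕ → ℕ → ℕ) → ∑[ i + j ≡ m ] g i j * c ≡ (∑[ i + j ≡ m ] g i j) * c
antidiagonalSum-*ʳ zero    c g = refl
antidiagonalSum-*ʳ (suc m) c g =
  trans (cong (g 0 (suc m) * c +_) (antidiagonalSum-*ʳ m c _)) (sym (*-distribʳ-+ c (g 0 (suc m)) _))

antidiagonalSum-sucʳ : ∀ m (g : ℕ → ℕ → ℕ) →
                       ∑[ i + j ≡ suc m ] g i j ≡ (∑[ i + j ≡ m ] g i (suc j)) + g (suc m) 0
antidiagonalSum-sucʳ zero    g = refl
antidiagonalSum-sucʳ (suc m) g =
  trans (cong (g 0 (2 + m) +_) (antidiagonalSum-sucʳ m (λ i j → g (suc i) j)))
        (sym (+-assoc (g 0 (2 + m)) _ _))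

antidiagonalSum-comm : ∀ m (g : ℕ → ℕ → ℕ) → ∑[ i + j ≡ m ] g i j ≡ ∑[ i + j ≡ m ] g j i
antidiagonalSum-comm zero    g = refl
antidiagonalSum-comm (suc m) g = begin
  g 0 (suc m) + (∑[ i + j ≡ m ] g (suc i) j) ≡⟨ cong (g 0 (suc m) +_) (antidiagonalSum-comm m _) ⟩
  g 0 (suc m) + (∑[ i + j ≡ m ] g (suc j) i) ≡⟨ +-comm (g 0 (suc m)) _ ⟩
  (∑[ i + j ≡ m ] g (suc j) i) + g 0 (suc m) ≡⟨ antidiagonalSum-sucʳ m (λ i j → g j i) ⟨
  ∑[ i + j ≡ suc m ] g j i                   ∎

antidiagonalSum-assoc : ∀ m (g : ℕ → ℕ → ℕ → ℕ) →
                        ∑[ a + c ≡ m ] ∑[ b + d ≡ c ] g a b d ≡ ∑[ s + d ≡ m ] ∑[ a + b ≡ s ] g a b d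
antidiagonalSum-assoc zero    g = refl
antidiagonalSum-assoc (suc m) g = begin
  (∑[ b + d ≡ suc m ] g 0 b d) + (∑[ a + c ≡ m ] ∑[ b + d ≡ c ] g (suc a) b d)
    ≡⟨ cong ((∑[ b + d ≡ suc m ] g 0 b d) +_) (antidiagonalSum-assoc m (g ∘ suc)) ⟩
  g 0 0 (suc m) + (∑[ b + d ≡ m ] g 0 (suc b) d) + (∑[ s + d ≡ m ] ∑[ a + b ≡ s ] g (suc a) b d)
    ≡⟨ +-assoc (g 0 0 (suc m)) _ _ ⟩
  g 0 0 (suc m) + ((∑[ b + d ≡ m ] g 0 (suc b) d) + (∑[ s + d ≡ m ] ∑[ a + b ≡ s ] g (suc a) b d))
    ≡⟨ cong (g 0 0 (suc m) +_) (antidiagonalSum-+ m _ _) ⟨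
  ∑[ s + d ≡ suc m ] ∑[ a + b ≡ s ] g a b d ∎

antidiagonalSum-swap : ∀ m (g : ℕ → ℕ → ℕ → ℕ) →
                       ∑[ a + c ≡ m ] ∑[ b + d ≡ c ] g a b d ≡ ∑[ b + c ≡ m ] ∑[ a + d ≡ c ] g a b d
antidiagonalSum-swap m g = begin
  ∑[ a + c ≡ m ] ∑[ b + d ≡ c ] g a b d ≡⟨ antidiagonalSum-assoc m g ⟩
  ∑[ s + d ≡ m ] ∑[ a + b ≡ s ] g a b d ≡⟨ antidiagonalSum-cong m (λ s d _ → antidiagonalSum-comm s _) ⟩
  ∑[ s + d ≡ m ] ∑[ b + a ≡ s ] g a b d ≡⟨ antidiagonalSum-assoc m (λ b a d → g a b d) ⟨
  ∑[ b + c ≡ m ] ∑[ a + d ≡ c ] g a b d ∎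

∑-upTo : ∀ m (g : ℕ → ℕ → ℕ) → ∑[ k ∈ upTo (suc m) ] g k (m ∸ k) ≡ ∑[ i + j ≡ m ] g i j
∑-upTo m g = trans (cong sum (map-applyUpTo id _ (suc m))) (sum-applyUpTo m g)
  where
  sum-applyUpTo : ∀ m (g : ℕ → ℕ → ℕ) →
                  sum (applyUpTo (λ k → g k (m ∸ k)) (suc m)) ≡ ∑[ i + j ≡ m ] g i j
  sum-applyUpTo zero    g = +-identityʳ (g 0 0)
  sum-applyUpTo (suc m) g = cong (g 0 (suc m) +_) (sum-applyUpTo m (g ∘ suc))

compsF-fuel : ∀ {f g n} → n ≤ f → n ≤ g → compsF f n ≡ compsF g n
compsF-fuel {n = zero}              _         _         = refl
compsF-fuel {suc f} {suc g} {suc m} (s≤s m≤f) (s≤s m≤g) =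
  concatMap-cong fuel-irrelevant (upTo (suc m))
  where
  fuel-irrelevant : ∀ k → map (suc k ∷_) (compsF f (m ∸ k)) ≡ map (suc k ∷_) (compsF g (m ∸ k))
  fuel-irrelevant k =
    cong (map (suc k ∷_)) (compsF-fuel (≤-trans (m∸n≤m m k) m≤f) (≤-trans (m∸n≤m m k) m≤g))

compositions-suc : ∀ m →
  compositions (suc m) ≡ concatMap (λ k → map (suc k ∷_) (compositions (m ∸ k))) (upTo (suc m))
compositions-suc m =
  concatMap-cong (λ k → cong (map (suc k ∷_)) (compsF-fuel (m∸n≤m m k) ≤-refl)) (upTo (suc m))

∑-compositions-head : ∀ m (w : List ℕ → ℕ) →
  ∑[ σ ∈ compositions (suc m) ] w σ ≡ ∑[ k + c ≡ m ] ∑[ τ ∈ compositions c ] w (suc k ∷ τ)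
∑-compositions-head m w = begin
  ∑[ σ ∈ compositions (suc m) ] w σ
    ≡⟨ cong (λ σs → ∑[ σ ∈ σs ] w σ) (compositions-suc m) ⟩
  ∑[ σ ∈ concatMap (λ k → map (suc k ∷_) (compositions (m ∸ k))) (upTo (suc m)) ] w σ
    ≡⟨ ∑-concatMap w (λ k → map (suc k ∷_) (compositions (m ∸ k))) (upTo (suc m)) ⟩
  ∑[ k ∈ upTo (suc m) ] ∑[ σ ∈ map (suc k ∷_) (compositions (m ∸ k)) ] w σ
    ≡⟨ ∑-cong (λ k → ∑-map w (suc k ∷_) (compositions (m ∸ k))) (upTo (suc m)) ⟩
  ∑[ k ∈ upTo (suc m) ] ∑[ τ ∈ compositions (m ∸ k) ] w (suc k ∷ τ)
    ≡⟨ ∑-upTo m (λ k c → ∑[ τ ∈ compositions c ] w (suc k ∷ τ)) ⟩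
  ∑[ k + c ≡ m ] ∑[ τ ∈ compositions c ] w (suc k ∷ τ) ∎

-- Split by the first part, the remainder (inductively) by its last part, and exchange the roles
-- of the two outer parts.
∑-compositions-last : ∀ m (w : List ℕ → ℕ) →
  ∑[ σ ∈ compositions (suc m) ] w σ ≡ ∑[ k + c ≡ m ] ∑[ τ ∈ compositions c ] w (τ ++ suc k ∷ [])
∑-compositions-last = <-rec Claim step
  where
  Claim : ℕ → Set
  Claim m = ∀ w → ∑[ σ ∈ compositions (suc m) ] w σ
                  ≡ ∑[ k + c ≡ m ] ∑[ τ ∈ compositions c ] w (τ ++ suc k ∷ [])
  step : ∀ m → (∀ {c} → c < m → Claim c) → Claim m
  step zero    _  w = refl
  step (suc m) ih w = begin
    ∑[ σ ∈ compositions (2 + m) ] w σ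
      ≡⟨ ∑-compositions-head (suc m) w ⟩
    ∑[ a + c ≡ suc m ] ∑[ τ ∈ compositions c ] w (suc a ∷ τ)
      ≡⟨ antidiagonalSum-sucʳ m (λ a c → ∑[ τ ∈ compositions c ] w (suc a ∷ τ)) ⟩
    (∑[ a + c ≡ m ] ∑[ τ ∈ compositions (suc c) ] w (suc a ∷ τ)) + singleton
      ≡⟨ cong (_+ singleton) (antidiagonalSum-cong m λ a c a+c≡m →
           ih {c} (s≤s (antidiagonal-snd≤ a+c≡m)) (w ∘ (suc a ∷_))) ⟩
    (∑[ a + c ≡ m ] ∑[ b + d ≡ c ] ∑[ τ ∈ compositions d ] w (suc a ∷ τ ++ suc b ∷ [])) + singleton
      ≡⟨ cong (_+ singleton) (antidiagonalSum-swap m _) ⟩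
    (∑[ b + c ≡ m ] ∑[ a + d ≡ c ] ∑[ τ ∈ compositions d ] w (suc a ∷ τ ++ suc b ∷ [])) + singleton
      ≡⟨ cong (_+ singleton) (antidiagonalSum-cong m λ b c _ →
           ∑-compositions-head c (λ τ → w (τ ++ suc b ∷ []))) ⟨
    (∑[ b + c ≡ m ] ∑[ τ ∈ compositions (suc c) ] w (τ ++ suc b ∷ [])) + singleton
      ≡⟨ antidiagonalSum-sucʳ m (λ b c → ∑[ τ ∈ compositions c ] w (τ ++ suc b ∷ [])) ⟨
    ∑[ b + c ≡ suc m ] ∑[ τ ∈ compositions c ] w (τ ++ suc b ∷ []) ∎
    where
    singleton : ℕ
    singleton = w (2 + m ∷ []) + 0

-- Out of range the value is a junk 0; it is only read at indices below the length.
infixl 9 _!_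
_!_ : List ℕ → ℕ → ℕ
[]       ! _     = 0
(x ∷ xs) ! zero  = x
(x ∷ xs) ! suc i = xs ! i

lookup≡! : (σ : List ℕ) (i : Fin (length σ)) → lookup σ i ≡ σ ! toℕ i
lookup≡! (x ∷ σ) Fin.zero    = refl
lookup≡! (x ∷ σ) (Fin.suc i) = lookup≡! σ i

!-++ˡ : (τ ρ : List ℕ) {i : ℕ} → i < length τ → (τ ++ ρ) ! i ≡ τ ! i
!-++ˡ (x ∷ τ) ρ {zero}  _       = refl
!-++ˡ (x ∷ τ) ρ {suc i} (s≤s i<) = !-++ˡ τ ρ i<

!-++ʳ : (τ : List ℕ) (b : ℕ) (ρ : List ℕ) → (τ ++ b ∷ ρ) ! length τ ≡ b
!-++ʳ []      b ρ = refl
!-++ʳ (x ∷ τ) b ρ = !-++ʳ τ b ρ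

pair-fst< : ∀ {i j n} → suc (i + j) ≡ n → i < n
pair-fst< {i} {j} eq = subst (i <_) eq (s≤s (m≤m+n i j))

pair-snd< : ∀ {i j n} → suc (i + j) ≡ n → j < n
pair-snd< {i} {j} eq = subst (j <_) eq (s≤s (m≤n+m j i))

2*n+1≡1+n+n : ∀ n → 2 * n + 1 ≡ suc (n + n)
2*n+1≡1+n+n = solve-∀

MirrorDistinct : List ℕ → Set
MirrorDistinct σ = ∀ i j → suc (i + j) ≡ length σ → i ≢ j → σ ! i ≢ σ ! j

antiPalindromic⇔mirrorDistinct : (σ : List ℕ) → AntiPalindromic σ ⇔ MirrorDistinct σ
antiPalindromic⇔mirrorDistinct σ = mk⇔ to from
  where
  to : AntiPalindromic σ → MirrorDistinct σ
  to ap i j i+j+1≡|σ| i≢j σi≡σj = ap k (i≢j ∘ middle⇒diagonal) (begin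
    lookup σ k            ≡⟨ lookup≡! σ k ⟩
    σ ! toℕ k             ≡⟨ cong (σ !_) (toℕ-fromℕ< (pair-fst< i+j+1≡|σ|)) ⟩
    σ ! i                 ≡⟨ σi≡σj ⟩
    σ ! j                 ≡⟨ cong (σ !_) opposite-k ⟨
    σ ! toℕ (opposite k)  ≡⟨ lookup≡! σ (opposite k) ⟨
    lookup σ (opposite k) ∎)
    where
    k : Fin (length σ)
    k = fromℕ< (pair-fst< i+j+1≡|σ|)
    toℕ-k : toℕ k ≡ i
    toℕ-k = toℕ-fromℕ< (pair-fst< i+j+1≡|σ|)
    opposite-k : toℕ (opposite k) ≡ j
    opposite-k = begin
      toℕ (opposite k)       ≡⟨ opposite-prop k ⟩
      length σ ∸ suc (toℕ k) ≡⟨ cong₂ (λ n x → n ∸ suc x) (sym i+j+1≡|σ|) toℕ-k ⟩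
      i + j ∸ i              ≡⟨ m+n∸m≡n i j ⟩
      j                      ∎
    middle⇒diagonal : 2 * toℕ k + 1 ≡ length σ → i ≡ j
    middle⇒diagonal middle = +-cancelˡ-≡ i i j (suc-injective (begin
      suc (i + i)   ≡⟨ 2*n+1≡1+n+n i ⟨
      2 * i + 1     ≡⟨ cong (λ x → 2 * x + 1) toℕ-k ⟨
      2 * toℕ k + 1 ≡⟨ middle ⟩
      length σ      ≡⟨ i+j+1≡|σ| ⟨
      suc (i + j)   ∎))

  from : MirrorDistinct σ → AntiPalindromic σ
  from md k not-middle σk≡σk′ =
    md (toℕ k) (toℕ (opposite k)) pair-sum diagonal⇒middle
       (trans (sym (lookup≡! σ k)) (trans σk≡σk′ (lookup≡! σ (opposite k))))
    where
    pair-sum : suc (toℕ k + toℕ (opposite k)) ≡ length σ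
    pair-sum = trans (cong (λ x → suc (toℕ k + x)) (opposite-prop k)) (m+[n∸m]≡n (toℕ<n k))
    diagonal⇒middle : toℕ k ≢ toℕ (opposite k)
    diagonal⇒middle k≡k′ =
      not-middle (trans (2*n+1≡1+n+n (toℕ k)) (trans (cong (λ x → suc (toℕ k + x)) k≡k′) pair-sum))

length-∷∷ʳ : ∀ (a b : ℕ) τ → length (a ∷ τ ++ b ∷ []) ≡ 2 + length τ
length-∷∷ʳ a b τ = cong suc (trans (length-++ τ) (+-comm (length τ) 1))

mirrorDistinct-∷∷ʳ : ∀ a b τ → MirrorDistinct (a ∷ τ ++ b ∷ []) ⇔ (a ≢ b × MirrorDistinct τ)
mirrorDistinct-∷∷ʳ a b τ = mk⇔ to from
  where
  σ : List ℕ
  σ = a ∷ τ ++ b ∷ []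
  |σ| : length σ ≡ 2 + length τ
  |σ| = length-∷∷ʳ a b τ
  σ-last : σ ! suc (length τ) ≡ b
  σ-last = !-++ʳ τ b []
  σ-inner : ∀ {i} → i < length τ → σ ! suc i ≡ τ ! i
  σ-inner = !-++ˡ τ (b ∷ [])
  inner-pair : ∀ {i j} → suc (suc i + suc j) ≡ length σ → suc (i + j) ≡ length τ
  inner-pair {i} {j} eq = trans (sym (+-suc i j)) (suc-injective (suc-injective (trans eq |σ|)))
  outer-pair : ∀ {i j} → suc (i + j) ≡ length τ → suc (suc i + suc j) ≡ length σ
  outer-pair {i} {j} eq = trans (cong (2 +_) (trans (+-suc i j) eq)) (sym |σ|)

  to : MirrorDistinct σ → a ≢ b × MirrorDistinct τ
  to md = (λ a≡b → md 0 (suc (length τ)) (sym |σ|) (λ ()) (trans a≡b (sym σ-last)))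
        , λ i j eq i≢j τi≡τj → md (suc i) (suc j) (outer-pair eq) (i≢j ∘ suc-injective)
            (trans (σ-inner (pair-fst< eq)) (trans τi≡τj (sym (σ-inner (pair-snd< eq)))))

  from : a ≢ b × MirrorDistinct τ → MirrorDistinct σ
  from _        zero    zero    _  i≢j _  = i≢j refl
  from (a≢b , _) zero    (suc j) eq _   a≡σj =
    a≢b (trans a≡σj (trans (cong (λ x → σ ! suc x) (suc-injective (suc-injective (trans eq |σ|)))) σ-last))
  from (a≢b , _) (suc i) zero    eq _   σi≡a =
    a≢b (trans (sym σi≡a) (trans (cong (λ x → σ ! suc x) i≡|τ|) σ-last))
    where
    i≡|τ| : i ≡ length τ
    i≡|τ| = trans (sym (+-identityʳ i)) (suc-injective (suc-injective (trans eq |σ|)))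
  from (_ , md) (suc i) (suc j) eq i≢j σi≡σj =
    md i j (inner-pair eq) (i≢j ∘ cong suc)
       (trans (sym (σ-inner (pair-fst< (inner-pair eq)))) (trans σi≡σj (σ-inner (pair-snd< (inner-pair eq)))))

OddAntiPalindromic : List ℕ → Set
OddAntiPalindromic σ = T (Odd? (length σ)) × AntiPalindromic σ

oddAntiPalindromic? : (σ : List ℕ) → Dec (OddAntiPalindromic σ)
oddAntiPalindromic? σ = T? (Odd? (length σ)) ×-dec antiPal? σ

oddAntiPalindromic-∷∷ʳ : ∀ a b τ → OddAntiPalindromic (a ∷ τ ++ b ∷ []) ⇔ (a ≢ b × OddAntiPalindromic τ)
oddAntiPalindromic-∷∷ʳ a b τ = mk⇔
  (λ (odd , ap) → let a≢b , mdτ = to (mirrorDistinct-∷∷ʳ a b τ) (to (antiPalindromic⇔mirrorDistinct σ) ap)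
                  in a≢b , subst T odd-σ≡odd-τ odd , from (antiPalindromic⇔mirrorDistinct τ) mdτ)
  (λ (a≢b , odd , apτ) → subst T (sym odd-σ≡odd-τ) odd
    , from (antiPalindromic⇔mirrorDistinct σ)
           (from (mirrorDistinct-∷∷ʳ a b τ) (a≢b , to (antiPalindromic⇔mirrorDistinct τ) apτ)))
  where
  open Equivalence
  σ : List ℕ
  σ = a ∷ τ ++ b ∷ []
  odd-σ≡odd-τ : Odd? (length σ) ≡ Odd? (length τ)
  odd-σ≡odd-τ = trans (cong Odd? (length-∷∷ʳ a b τ)) (not-involutive (Odd? (length τ)))

indicator : Bool → ℕ
indicator true  = 1
indicator false = 0

indicator-∧ : ∀ x y → indicator (x ∧ y) ≡ indicator x * indicator y
indicator-∧ true  y = sym (+-identityʳ (indicator y))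
indicator-∧ false y = refl

length-filter≡∑ : {P : A → Set} (P? : ∀ x → Dec (P x)) (xs : List A) →
                  length (filter P? xs) ≡ ∑[ x ∈ xs ] indicator (does (P? x))
length-filter≡∑ P? []       = refl
length-filter≡∑ P? (x ∷ xs) with does (P? x)
... | true  = cong suc (length-filter≡∑ P? xs)
... | false = length-filter≡∑ P? xs

weight : List ℕ → ℕ
weight σ = indicator (does (oddAntiPalindromic? σ))

ac₁≡∑weight : ∀ n → ac₁ n ≡ ∑[ σ ∈ compositions n ] weight σ
ac₁≡∑weight n = length-filter≡∑ oddAntiPalindromic? (compositions n)

weight-singleton : ∀ a → weight (a ∷ []) ≡ 1
weight-singleton a =
  cong indicator (dec-true (oddAntiPalindromic? (a ∷ [])) (tt , λ { Fin.zero not-middle _ → not-middle refl }))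

weight-∷∷ʳ : ∀ a b τ → weight (a ∷ τ ++ b ∷ []) ≡ indicator (not (does (a ≟ b))) * weight τ
weight-∷∷ʳ a b τ =
  trans (cong indicator (does-⇔ (oddAntiPalindromic-∷∷ʳ a b τ)
                                (oddAntiPalindromic? (a ∷ τ ++ b ∷ []))
                                (¬? (a ≟ b) ×-dec oddAntiPalindromic? τ)))
        (indicator-∧ (not (does (a ≟ b))) _)

offDiagonal : ℕ → ℕ
offDiagonal s = ∑[ i + j ≡ s ] indicator (not (does (i ≟ j)))

offDiagonal⋆ : (ℕ → ℕ) → ℕ → ℕ
offDiagonal⋆ u m = ∑[ s + d ≡ m ] offDiagonal s * u d

ac₁-recurrence : ∀ m → ac₁ (2 + m) ≡ 1 + offDiagonal⋆ ac₁ m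
ac₁-recurrence m = begin
  ac₁ (2 + m)
    ≡⟨ ac₁≡∑weight (2 + m) ⟩
  ∑[ σ ∈ compositions (2 + m) ] weight σ
    ≡⟨ ∑-compositions-head (suc m) weight ⟩
  ∑[ a + c ≡ suc m ] ∑[ τ ∈ compositions c ] weight (suc a ∷ τ)
    ≡⟨ antidiagonalSum-sucʳ m (λ a c → ∑[ τ ∈ compositions c ] weight (suc a ∷ τ)) ⟩
  (∑[ a + c ≡ m ] ∑[ τ ∈ compositions (suc c) ] weight (suc a ∷ τ)) + (weight (2 + m ∷ []) + 0)
    ≡⟨ cong₂ _+_ (antidiagonalSum-cong m λ a c _ → ∑-compositions-last c (weight ∘ (suc a ∷_)))
                 (cong (_+ 0) (weight-singleton (2 + m))) ⟩
  (∑[ a + c ≡ m ] ∑[ b + d ≡ c ] ∑[ τ ∈ compositions d ] weight (suc a ∷ τ ++ suc b ∷ [])) + 1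
    ≡⟨ cong (_+ 1) (antidiagonalSum-cong m λ a c _ → antidiagonalSum-cong c λ b d _ → inner a b d) ⟩
  (∑[ a + c ≡ m ] ∑[ b + d ≡ c ] indicator (not (does (a ≟ b))) * ac₁ d) + 1
    ≡⟨ cong (_+ 1) (antidiagonalSum-assoc m (λ a b d → indicator (not (does (a ≟ b))) * ac₁ d)) ⟩
  (∑[ s + d ≡ m ] ∑[ a + b ≡ s ] indicator (not (does (a ≟ b))) * ac₁ d) + 1
    ≡⟨ cong (_+ 1) (antidiagonalSum-cong m λ s d _ → antidiagonalSum-*ʳ s (ac₁ d) _) ⟩
  offDiagonal⋆ ac₁ m + 1
    ≡⟨ +-comm _ 1 ⟩
  1 + offDiagonal⋆ ac₁ m ∎
  where
  inner : ∀ a b d → ∑[ τ ∈ compositions d ] weight (suc a ∷ τ ++ suc b ∷ [])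
                    ≡ indicator (not (does (a ≟ b))) * ac₁ d
  inner a b d = begin
    ∑[ τ ∈ compositions d ] weight (suc a ∷ τ ++ suc b ∷ [])
      ≡⟨ ∑-cong (weight-∷∷ʳ (suc a) (suc b)) (compositions d) ⟩
    ∑[ τ ∈ compositions d ] indicator (not (does (a ≟ b))) * weight τ
      ≡⟨ ∑-*ˡ (indicator (not (does (a ≟ b)))) weight (compositions d) ⟩
    indicator (not (does (a ≟ b))) * (∑[ τ ∈ compositions d ] weight τ)
      ≡⟨ cong (indicator (not (does (a ≟ b))) *_) (ac₁≡∑weight d) ⟨
    indicator (not (does (a ≟ b))) * ac₁ d ∎

offDiagonal-+2 : ∀ s → offDiagonal (2 + s) ≡ offDiagonal s + 2
offDiagonal-+2 s =
  trans (cong suc (antidiagonalSum-sucʳ s (λ i j → indicator (not (does (suc i ≟ j))))))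
        (sym (+-suc (offDiagonal s) 1))

offDiagonal⋆-+2 : ∀ u m →
  offDiagonal⋆ u (2 + m) ≡ 2 * u (1 + m) + offDiagonal⋆ u m + 2 * (∑[ i + j ≡ m ] u j)
offDiagonal⋆-+2 u m = begin
  2 * u (1 + m) + (∑[ s + d ≡ m ] offDiagonal (2 + s) * u d)
    ≡⟨ cong (2 * u (1 + m) +_) (antidiagonalSum-cong m λ s d _ →
         trans (cong (_* u d) (offDiagonal-+2 s)) (*-distribʳ-+ (u d) (offDiagonal s) 2)) ⟩
  2 * u (1 + m) + (∑[ s + d ≡ m ] offDiagonal s * u d + 2 * u d)
    ≡⟨ cong (2 * u (1 + m) +_) (antidiagonalSum-+ m (λ s d → offDiagonal s * u d) (λ _ d → 2 * u d)) ⟩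
  2 * u (1 + m) + (offDiagonal⋆ u m + (∑[ i + j ≡ m ] 2 * u j))
    ≡⟨ cong (λ x → 2 * u (1 + m) + (offDiagonal⋆ u m + x)) (antidiagonalSum-*ˡ m 2 (λ _ j → u j)) ⟩
  2 * u (1 + m) + (offDiagonal⋆ u m + 2 * (∑[ i + j ≡ m ] u j))
    ≡⟨ +-assoc (2 * u (1 + m)) _ _ ⟨
  2 * u (1 + m) + offDiagonal⋆ u m + 2 * (∑[ i + j ≡ m ] u j) ∎

-- At n = 1 the formula of the theorem gives 0, whereas ac₁ 1 = 1.
closedForm : ℕ → ℕ
closedForm 1 = 1
closedForm n = f3 (n ∸ 3) + f3 (n ∸ 1)

f3-+2 : ∀ m → f3 (2 + m) ≡ f3 (1 + m) + f3 m + f3 (m ∸ 1)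
f3-+2 zero    = refl
f3-+2 (suc m) = refl

closedForm-tribonacci : ∀ m →
  closedForm (5 + m) ≡ closedForm (4 + m) + closedForm (3 + m) + closedForm (2 + m)
closedForm-tribonacci m = step (f3 (3 + m)) (f3 (1 + m)) (f3 m) (f3 (m ∸ 1)) (f3-+2 m)
  where
  step : ∀ y a b c {x} → x ≡ a + b + c → x + (y + x + a) ≡ a + y + (b + x) + (c + a)
  step y a b c refl = identity y a b c
    where
    identity : ∀ y a b c → a + b + c + (y + (a + b + c) + a) ≡ a + y + (b + (a + b + c)) + (c + a)
    identity = solve-∀

closedForm-+4 : ∀ m → closedForm (4 + m)
                      ≡ closedForm (2 + m) + 2 * closedForm (1 + m) + 2 * (∑[ i + j ≡ m ] closedForm j)
closedForm-+4 zero    = refl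
closedForm-+4 (suc m) = begin
  closedForm (5 + m)
    ≡⟨ closedForm-tribonacci m ⟩
  closedForm (4 + m) + closedForm (3 + m) + closedForm (2 + m)
    ≡⟨ cong (λ x → x + closedForm (3 + m) + closedForm (2 + m)) (closedForm-+4 m) ⟩
  closedForm (2 + m) + 2 * closedForm (1 + m) + 2 * P + closedForm (3 + m) + closedForm (2 + m)
    ≡⟨ identity (closedForm (2 + m)) (closedForm (1 + m)) P (closedForm (3 + m)) ⟩
  closedForm (3 + m) + 2 * closedForm (2 + m) + 2 * (closedForm (1 + m) + P) ∎
  where
  P : ℕ
  P = ∑[ i + j ≡ m ] closedForm j
  identity : ∀ a b p c → a + 2 * b + 2 * p + c + a ≡ c + 2 * a + 2 * (b + p)
  identity = solve-∀

closedForm-recurrence : ∀ m → closedForm (2 + m) ≡ 1 + offDiagonal⋆ closedForm m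
closedForm-recurrence zero          = refl
closedForm-recurrence (suc zero)    = refl
closedForm-recurrence (suc (suc m)) = begin
  closedForm (4 + m)
    ≡⟨ closedForm-+4 m ⟩
  closedForm (2 + m) + 2 * closedForm (1 + m) + 2 * P
    ≡⟨ cong (λ x → x + 2 * closedForm (1 + m) + 2 * P) (closedForm-recurrence m) ⟩
  1 + offDiagonal⋆ closedForm m + 2 * closedForm (1 + m) + 2 * P
    ≡⟨ identity (offDiagonal⋆ closedForm m) (closedForm (1 + m)) P ⟩
  1 + (2 * closedForm (1 + m) + offDiagonal⋆ closedForm m + 2 * P)
    ≡⟨ cong (1 +_) (offDiagonal⋆-+2 closedForm m) ⟨
  1 + offDiagonal⋆ closedForm (2 + m) ∎
  where
  P : ℕ
  P = ∑[ i + j ≡ m ] closedForm j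
  identity : ∀ v a p → 1 + v + 2 * a + 2 * p ≡ 1 + (2 * a + v + 2 * p)
  identity = solve-∀

recurrence-unique : ∀ {u v : ℕ → ℕ} → u 0 ≡ v 0 → u 1 ≡ v 1 →
                    (∀ m → u (2 + m) ≡ 1 + offDiagonal⋆ u m) → (∀ m → v (2 + m) ≡ 1 + offDiagonal⋆ v m) →
                    ∀ n → u n ≡ v n
recurrence-unique {u} {v} u0≡v0 u1≡v1 u-rec v-rec = <-rec (λ n → u n ≡ v n) step
  where
  step : ∀ n → (∀ {d} → d < n → u d ≡ v d) → u n ≡ v n
  step zero          _  = u0≡v0
  step (suc zero)    _  = u1≡v1
  step (suc (suc m)) ih = begin
    u (2 + m)              ≡⟨ u-rec m ⟩
    1 + offDiagonal⋆ u m   ≡⟨ cong (1 +_) (antidiagonalSum-cong m λ s d s+d≡m →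
                                cong (offDiagonal s *_) (ih (m≤n⇒m≤1+n (s≤s (antidiagonal-snd≤ s+d≡m))))) ⟩
    1 + offDiagonal⋆ v m   ≡⟨ v-rec m ⟨
    v (2 + m)              ∎

proposition7 : (n : ℕ) → 2 ≤ n → ac₁ n ≡ f3 (n ∸ 3) + f3 (n ∸ 1)
proposition7 (suc (suc m)) _ = recurrence-unique refl refl ac₁-recurrence closedForm-recurrence (2 + m)
proposition7 (suc zero) (s≤s ())
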